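{- Let $T_{\mathrm{own}}$ be a transport functor from $\mathsf{Fin}^I$ to $\mathsf{Fin}$ deduced from a transport situation $(T,(\mathrm{own}_i)_{i\in I})$, and assume the web functor $T$ is continuous and the ownership relation $(\mathrm{own}_i)_{i\in I}$ is local. Then $T_{\mathrm{own}}$ is directly continuous.
   Context: Finiteness spaces $\mathcal A=(|\mathcal A|,\mathfrak F(\mathcal A))$: a set with $\mathfrak F(\mathcal A)\subseteq\mathcal P(|\mathcal A|)$ equal to its bidual, where $\mathfrak A^\perp=\{a': a\cap a'\text{ finite }\forall a\in\mathfrak A\}$; $\mathcal A^\perp=(|\mathcal A|,\mathfrak F(\mathcal A)^\perp)$. For relations: $f[a]$ direct image, $f^\dagger$ reverse, $f\backslash b=\{\alpha: f[\{\alpha\}]\subseteq b\}$, quasi-functional means $f[\{\alpha\}]$ finite for all $\alpha$; $f$ is finitary from $\mathcal A$ to $\mathcal B$ if $f[a]\in\mathfrak F(\mathcal B)$ for $a\in\mathfrak F(\mathcal A)$ and $f^\dagger[b']\in\mathfrak F(\mathcal A^\perp)$ for $b'\in\mathfrak F(\mathcal B^\perp)$. A functor $T$ from $\mathsf{Rel}^I$ to $\mathsf{Rel}$ assigns a set $T\vec A$ to each family of sets and a relation $T\vec f\subseteq T\vec A\times T\vec B$ to each family of relations $f_i\subseteq A_i\times B_i$ (independently of the chosen $A_i,B_i$), preserving componentwise identities and composition; it is continuous if, for every $I$-indexed family of inclusion-directed families of sets $(A_{i,j})_{j\in J_i}$, $T(\bigcup_{j}A_{i,j})_{i}=\bigcup_{\vec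 j\in\prod_iJ_i}T(A_{i,j_i})_{i}$. A lax natural transformation $\phi$ from $T$ to $U$ is a family $\phi_{\vec A}\subseteq T\vec A\times U\vec A$ with $\phi_{\vec B}\circ T\vec g\subseteq U\vec g\circ\phi_{\vec A}$. $\Pi_i$ is the $i$-th projection functor. A transport situation is such a $T$ with quasi-functional lax natural transformations $\mathrm{own}_i$ from $T$ to $\Pi_i$; it is local if for every family of sets $\vec A$ and all $i\in I$: $\mathrm{own}_i[\mathrm{own}_i\backslash a_i]=a_i$ for all $a_i\subseteq A_i$; $\mathrm{own}_j[\mathrm{own}_i\backslash a_i]=A_j$ for all $a_i\subseteq A_i$ and $j\neq i$; and $\mathrm{own}_i[\bigcap_k\hat a_k]=\bigcap_k\mathrm{own}_i[\hat a_k]$ for every family of subsets $\hat a_k\subseteq T\vec A$. $T_{\mathrm{own}}\vec{\mathcal A}$ is the finiteness space with web $T(|\mathcal A_i|)_i$ whose finitary subsets are the $\hat a$ with $\mathrm{own}_i[\hat a]\in\mathfrak F(\mathcal A_i)$ for all $i$, and $T_{\mathrm{own}}\vec f=T\vec f$; it is a transport functor when $T\vec f$ is finitary from $T_{\mathrm{own}}\vec{\mathcal A}$ to $T_{\mathrm{own}}\vec{\mathcal B}$ whenever each $f_i$ is finitary. Finiteness inclusion: $\mathcal A\sqsubseteq\mathcal B$ iff $|\mathcal A|\subseteq|\mathcal B|$ and $\mathfrak F(\mathcal A)\subseteq\mathfrak F(\mathcal B)$; the supremum $\bigsqcup_j\mathcal A_j$ has web $\bigcup_j|\mathcal A_j|$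 and structure $(\bigcup_j\mathfrak F(\mathcal A_j))^{\perp\perp}$. A functor $\mathcal T$ from $\mathsf{Fin}^I$ to $\mathsf{Fin}$ is directly continuous if it is $\sqsubseteq$-monotonic and, for every family $((\mathcal A_{i,j})_{j\in J_i})_{i\in I}$ with each $(\mathcal A_{i,j})_{j\in J_i}$ directed for $\sqsubseteq$, $\mathcal T(\bigsqcup_{j\in J_i}\mathcal A_{i,j})_{i\in I}=\bigsqcup_{\vec j\in\prod_iJ_i}\mathcal T(\mathcal A_{i,j_i})_{i\in I}$. -}

module Defs where

open import Level using (0ℓ)
open import Data.Product using (Σ; ∃; _×_; _,_)
open import Data.List using (List)
open import Data.List.Membership.Propositional renaming (_∈_ to _∈ˡ_)
open import Relation.Binary.PropositionalEquality using (_≡_; _≢_)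
open import Function using (_⇔_)

-- Sets are modelled as (0ℓ) predicates on an ambient type, relations as
-- binary predicates.  Equality of sets is extensional equality.

Sub : Set → Set₁
Sub A = A → Set

_⊆_ : {A : Set} → Sub A → Sub A → Set
a ⊆ b = ∀ {x} → a x → b x

_≐_ : {A : Set} → Sub A → Sub A → Set
a ≐ b = (a ⊆ b) × (b ⊆ a)

_∩_ : {A : Set} → Sub A → Sub A → Sub A
(a ∩ b) x = a x × b x

Finite : {A : Set} → Sub A → Set
Finite {A} a = Σ (List A) λ xs → ∀ {x} → a x → x ∈ˡ xs

Rel' : Set → Set → Set₁
Rel' A B = A → B → Set

_≐R_ : {A B : Set} → Rel' A B → Rel' A B → Set
f ≐R g = ∀ x y → (f x y → g x y) × (g x y → f x y)

idR : {A : Set} → Sub A → Rel' A A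
idR a x y = a x × x ≡ y

-- relational composition  g ∘R f  (first f, then g)
_∘R_ : {A B C : Set} → Rel' B C → Rel' A B → Rel' A C
(g ∘R f) x z = ∃ λ y → f x y × g y z

RelIn : {A B : Set} → Sub A → Sub B → Rel' A B → Set
RelIn a b f = ∀ x y → f x y → a x × b y

image : {A B : Set} → Rel' A B → Sub A → Sub B
image f a y = ∃ λ x → a x × f x y

rimage : {A B : Set} → Rel' A B → Sub B → Sub A
rimage f b x = ∃ λ y → b y × f x y

-- f \ b  = { α ∈ dom : f[{α}] ⊆ b }   (dom = source set of f)
back : {A B : Set} → Rel' A B → Sub A → Sub B → Sub A
back f dom b x = dom x × (∀ y → f x y → b y)

QuasiFunctional : {A B : Set} → Rel' A B → Set
QuasiFunctional f = ∀ x → Finite (f x)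

Orth : {A : Set} → Sub A → (Sub A → Set₁) → Sub A → Set₁
Orth w F a' = (a' ⊆ w) × (∀ a → F a → Finite (a ∩ a'))

record PreFin (A : Set) : Set₂ where
  field
    web : Sub A
    fin : Sub A → Set₁
open PreFin public

IsFinSp : {A : Set} → PreFin A → Set₁
IsFinSp P = ∀ a → fin P a ⇔ Orth (web P) (Orth (web P) (fin P)) a

_⊥ : {A : Set} → PreFin A → PreFin A
web (P ⊥) = web P
fin (P ⊥) = Orth (web P) (fin P)

Finitary : {A B : Set} → PreFin A → PreFin B → Rel' A B → Set₁
Finitary P Q f =
  (∀ a → fin P a → fin Q (image f a)) ×
  (∀ b' → fin (Q ⊥) b' → fin (P ⊥) (rimage f b'))

_⊑_ : {A : Set} → PreFin A → PreFin A → Set₁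
P ⊑ Q = (web P ⊆ web Q) × (∀ a → fin P a → fin Q a)

_≈F_ : {A : Set} → PreFin A → PreFin A → Set₁
P ≈F Q = (web P ≐ web Q) × (∀ a → fin P a ⇔ fin Q a)

⨆ : {A J : Set} → (J → PreFin A) → PreFin A
web (⨆ F) x = ∃ λ j → web (F j) x
fin (⨆ F) = Orth (web (⨆ F)) (Orth (web (⨆ F)) (λ a → ∃ λ j → fin (F j) a))

record Directed {ℓx ℓ} {X : Set ℓx} {J : Set} (_≤_ : X → X → Set ℓ) (F : J → X) : Set (ℓx Level.⊔ ℓ) where
  field
    inhabited : J
    upper : ∀ j k → ∃ λ l → (F j ≤ F l) × (F k ≤ F l)

-- Functors Rel^I → Rel, with input webs in U i and output web in V.

record RelFunctor (I : Set) (U : I → Set) (V : Set) : Set₁ where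
  field
    obj : ((i : I) → Sub (U i)) → Sub V
    mor : ((i : I) → Rel' (U i) (U i)) → Rel' V V
    obj-resp : ∀ A B → (∀ i → A i ≐ B i) → obj A ≐ obj B
    mor-resp : ∀ f g → (∀ i → f i ≐R g i) → mor f ≐R mor g
    mor-id : ∀ A → mor (λ i → idR (A i)) ≐R idR (obj A)
    mor-∘ : ∀ f g → mor (λ i → g i ∘R f i) ≐R (mor g ∘R mor f)
open RelFunctor public

Continuous : {I : Set} {U : I → Set} {V : Set} → RelFunctor I U V → Set₁
Continuous {I} {U} T =
  ∀ (J : I → Set) (A : (i : I) → J i → Sub (U i)) →
  (∀ i → Directed _⊆_ (A i)) →
  obj T (λ i x → ∃ λ j → A i j x)
    ≐ (λ t → ∃ λ (js : (i : I) → J i) → obj T (λ i → A i (js i)) t)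

-- transport situation: T together with quasi-functional lax natural
-- transformations own_i : T ⇒ Π_i
record TransportSituation (I : Set) (U : I → Set) (V : Set) : Set₁ where
  field
    T : RelFunctor I U V
    own : (i : I) → (A : (k : I) → Sub (U k)) → Rel' V (U i)
    own-typed : ∀ i A → RelIn (obj T A) (A i) (own i A)
    own-lax : ∀ i (A B : (k : I) → Sub (U k)) (g : (k : I) → Rel' (U k) (U k)) →
      (∀ k → RelIn (A k) (B k) (g k)) →
      ∀ x z → (own i B ∘R mor T g) x z → (g i ∘R own i A) x z
    own-qf : ∀ i A → QuasiFunctional (own i A)
open TransportSituation public

Local : {I : Set} {U : I → Set} {V : Set} → TransportSituation I U V → Set₁
Local {I} {U} {V} S =
  ∀ (A : (k : I) → Sub (U k)) (i : I) →
    (∀ a → a ⊆ A i →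
       image (own S i A) (back (own S i A) (obj (T S) A) a) ≐ a)
  × (∀ a → a ⊆ A i → ∀ j → j ≢ i →
       image (own S j A) (back (own S i A) (obj (T S) A) a) ≐ A j)
  × (∀ (K : Set) (â : K → Sub V) → (∀ k → â k ⊆ obj (T S) A) →
       image (own S i A) (λ t → obj (T S) A t × (∀ k → â k t))
         ≐ (λ y → A i y × (∀ k → image (own S i A) (â k) y)))

Town : {I : Set} {U : I → Set} {V : Set} → TransportSituation I U V →
       ((i : I) → PreFin (U i)) → PreFin V
web (Town S P) = obj (T S) (λ i → web (P i))
fin (Town S P) â =
  (â ⊆ obj (T S) (λ i → web (P i))) ×
  (∀ i → fin (P i) (image (own S i (λ k → web (P k))) â))

IsTransportFunctor : {I : Set} {U : I → Set} {V : Set} → TransportSituation I U V → Set₂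
IsTransportFunctor {I} {U} S =
  ∀ (P Q : (i : I) → PreFin (U i)) →
  (∀ i → IsFinSp (P i)) → (∀ i → IsFinSp (Q i)) →
  (f : (i : I) → Rel' (U i) (U i)) →
  (∀ i → RelIn (web (P i)) (web (Q i)) (f i)) →
  (∀ i → Finitary (P i) (Q i) (f i)) →
  Finitary (Town S P) (Town S Q) (mor (T S) f)

DirectlyContinuous : {I : Set} {U : I → Set} {V : Set} → TransportSituation I U V → Set₂
DirectlyContinuous {I} {U} S =
  (∀ (P Q : (i : I) → PreFin (U i)) →
     (∀ i → IsFinSp (P i)) → (∀ i → IsFinSp (Q i)) →
     (∀ i → P i ⊑ Q i) → Town S P ⊑ Town S Q)
  ×
  (∀ (J : I → Set) (P : (i : I) → J i → PreFin (U i)) →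
     (∀ i j → IsFinSp (P i j)) →
     (∀ i → Directed _⊑_ (P i)) →
     Town S (λ i → ⨆ (P i))
       ≈F ⨆ (λ (js : (i : I) → J i) → Town S (λ i → P i (js i))))

module Submission where

-- Monotonicity is immediate: T is monotone on webs, and the owners of a point
-- of a smaller web are the same in a larger one, so owner-images shrink.
-- For directed families (P i j)_j the webs of T_own (⨆ P) and ⨆_js T_own (P js)
-- agree by continuity of T.  For the structures, the owner-images of a set
-- orthogonal to the supremum are orthogonal to every P i j (locality turns
-- a ∈ P i j into the generator of points owned in a).  A finitary â of
-- T_own (⨆ P) therefore meets such a set only at points with finitely many
-- relevant owners, covered by a single js thanks to directedness; points
-- without any owner are handled by the ownerless lemma: they lie in T B for
-- every B containing the finite coordinates.  That lemma is the heart of the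
-- proof: an ownerless point is copied infinitely often along a replication of
-- its finite support; since T_own is a transport functor, the copies collected
-- back onto it form a finite set, so two copies coincide, placing the point in
-- T of their overlap.

open import Defs
open import Axiom.ExcludedMiddle using (ExcludedMiddle)
open import Axiom.UniquenessOfIdentityProofs using (module Decidable⇒UIP)
open import Level using (0ℓ; Lift; lift; lower) renaming (suc to lsuc)
open import Data.Product using (∃; _×_; _,_; proj₁; proj₂)
open import Data.Sum using (_⊎_; inj₁; inj₂)
open import Data.Empty using (⊥-elim) renaming (⊥ to Empty)
open import Data.Bool using (Bool; true; false)
open import Data.Unit using (⊤; tt)
open import Data.Nat using (ℕ; zero; suc; _+_; _*_; _<_; s≤s)
open import Data.Nat.Properties using (<-cmp; n<1+n; <⇒≢; +-cancelˡ-≡; *-cancelʳ-≡; m≤n⇒m<n∨m≡n)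
open import Data.Nat.DivMod using (_%_; [m+kn]%n≡m%n; m<n⇒m%n≡m)
open import Data.Fin using (Fin; toℕ)
open import Data.Fin.Properties using (toℕ<n; toℕ-injective; pigeonhole)
open import Data.List using (List; []; _∷_; _++_; length; lookup; concatMap)
open import Data.List.Membership.Propositional using (lose) renaming (_∈_ to _∈ˡ_; _∉_ to _∉ˡ_)
open import Data.List.Membership.Propositional.Properties using (∈-++⁺ˡ; ∈-++⁺ʳ; ∈-concatMap⁺)
open import Data.List.Relation.Unary.Any using (here; there; index)
open import Data.List.Relation.Unary.Any.Properties using (lookup-index)
open import Relation.Binary.Definitions using (DecidableEquality; tri<; tri≈; tri>)
open import Relation.Binary.PropositionalEquality using (_≡_; _≢_; refl; sym; trans; cong; subst; module ≡-Reasoning)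
open import Relation.Nullary using (¬_; Dec; yes; no)
open import Function using (mk⇔; Equivalence)

finite-⊆ : {A : Set} {a b : Sub A} → b ⊆ a → Finite a → Finite b
finite-⊆ b⊆a (xs , a⊆xs) = xs , λ bx → a⊆xs (b⊆a bx)

finite-⊎ : {A : Set} {a b : Sub A} → Finite a → Finite b → Finite (λ x → a x ⊎ b x)
finite-⊎ (xs , a⊆xs) (ys , b⊆ys) =
  xs ++ ys , λ { (inj₁ ax) → ∈-++⁺ˡ (a⊆xs ax) ; (inj₂ bx) → ∈-++⁺ʳ xs (b⊆ys bx) }

image-finite : {A B : Set} (R : Rel' A B) → QuasiFunctional R → {a : Sub A} → Finite a → Finite (image R a)
image-finite R qf (xs , a⊆xs) =
  concatMap (λ x → proj₁ (qf x)) xs ,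
  λ { {y} (x , ax , Rxy) → ∈-concatMap⁺ (λ x → proj₁ (qf x))
        (lose {P = λ x → y ∈ˡ proj₁ (qf x)} (a⊆xs ax) (proj₂ (qf x) Rxy)) }

subsingleton-finite : ExcludedMiddle 0ℓ → {A : Set} {a : Sub A} →
  (∀ {x x'} → a x → a x' → x ≡ x') → Finite a
subsingleton-finite em {A} {a} unique with em {∃ a}
... | yes (x , ax) = x ∷ [] , λ ax' → here (unique ax' ax)
... | no ∄a = [] , λ ax → ⊥-elim (∄a (_ , ax))

finite-if-finite : ExcludedMiddle 0ℓ → {A : Set} (a : Sub A) → Finite (λ x → Finite a × a x)
finite-if-finite em a with em {Finite a}
... | yes (xs , a⊆xs) = xs , λ { (_ , ax) → a⊆xs ax }
... | no infinite = [] , λ { (fin-a , _) → ⊥-elim (infinite fin-a) }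

finite-by-labels : ExcludedMiddle 0ℓ → {A B : Set} (R : Rel' A B) {c : Sub A} {d : Sub B} →
  Finite d → (∀ {x x' y} → c x → c x' → R x y → R x' y → x ≡ x') →
  (∀ {x} → c x → ∃ λ y → d y × R x y) → Finite c
finite-by-labels em R {c} d-finite labels-distinct labelled =
  finite-⊆ (λ cx → let (y , dy , Rxy) = labelled cx in y , dy , cx , Rxy)
    (image-finite (λ y x → c x × R x y)
      (λ y → subsingleton-finite em (λ (cx , Rxy) (cx' , Rx'y) → labels-distinct cx cx' Rxy Rx'y))
      d-finite)

sequence-repeats : {A : Set} (xs : List A) (s : ℕ → A) → (∀ n → s n ∈ˡ xs) →
  ∃ λ m → ∃ λ n → m ≢ n × s m ≡ s n
sequence-repeats xs s s∈xs with pigeonhole (n<1+n (length xs)) (λ k → index (s∈xs (toℕ k)))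
... | (k , l , k<l , same-index) =
  toℕ k , toℕ l , <⇒≢ k<l ,
  trans (lookup-index (s∈xs (toℕ k)))
        (trans (cong (lookup xs) same-index) (sym (lookup-index (s∈xs (toℕ l)))))

infinite-fresh : ExcludedMiddle 0ℓ → {A : Set} {a : Sub A} → ¬ Finite a →
  (xs : List A) → ∃ λ x → x ∉ˡ xs
infinite-fresh em {a = a} infinite xs with em {∃ λ x → a x × x ∉ˡ xs}
... | yes (x , _ , x∉xs) = x , x∉xs
... | no none-outside = ⊥-elim (infinite (xs , a⊆xs))
  where
  a⊆xs : ∀ {x} → a x → x ∈ˡ xs
  a⊆xs {x} ax with em {x ∈ˡ xs}
  ... | yes x∈xs = x∈xs
  ... | no x∉xs = ⊥-elim (none-outside (x , ax , x∉xs))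

module FreshSequence {A : Set} (fresh : (xs : List A) → ∃ λ x → x ∉ˡ xs) where
  prefix : ℕ → List A
  term : ℕ → A
  prefix zero = []
  prefix (suc n) = term n ∷ prefix n
  term n = proj₁ (fresh (prefix n))

  term∈prefix : ∀ {m n} → m < n → term m ∈ˡ prefix n
  term∈prefix {m} {suc n} (s≤s m≤n) with m≤n⇒m<n∨m≡n m≤n
  ... | inj₁ m<n = there (term∈prefix m<n)
  ... | inj₂ refl = here refl

  term-injective : ∀ {m n} → term m ≡ term n → m ≡ n
  term-injective {m} {n} same with <-cmp m n
  ... | tri< m<n _ _ = ⊥-elim (proj₂ (fresh (prefix n)) (subst (_∈ˡ prefix n) same (term∈prefix m<n)))
  ... | tri≈ _ m≡n _ = m≡n
  ... | tri> _ _ n<m = ⊥-elim (proj₂ (fresh (prefix m)) (subst (_∈ˡ prefix m) (sym same) (term∈prefix n<m)))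

pair : ∀ {n} → ℕ → Fin n → ℕ
pair {n} σ k = toℕ k + σ * n

pair-injective : ∀ {n} {σ σ' : ℕ} {k k' : Fin n} → pair σ k ≡ pair σ' k' → σ ≡ σ' × k ≡ k'
pair-injective {suc n} {σ} {σ'} {k} {k'} same = σ≡σ' , toℕ-injective k≡k'
  where
  open ≡-Reasoning
  k≡k' : toℕ k ≡ toℕ k'
  k≡k' = begin
    toℕ k                         ≡⟨ sym (m<n⇒m%n≡m (toℕ<n k)) ⟩
    toℕ k % suc n                 ≡⟨ sym ([m+kn]%n≡m%n (toℕ k) σ (suc n)) ⟩
    (toℕ k + σ * suc n) % suc n   ≡⟨ cong (_% suc n) same ⟩
    (toℕ k' + σ' * suc n) % suc n ≡⟨ [m+kn]%n≡m%n (toℕ k') σ' (suc n) ⟩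
    toℕ k' % suc n                ≡⟨ m<n⇒m%n≡m (toℕ<n k') ⟩
    toℕ k'                        ∎
  σ≡σ' : σ ≡ σ'
  σ≡σ' = *-cancelʳ-≡ σ σ' (suc n)
    (+-cancelˡ-≡ (toℕ k) _ _ (trans same (cong (_+ σ' * suc n) (sym k≡k'))))

module FinSpace {A : Set} (P : PreFin A) (isP : IsFinSp P) where
  finitary-⊆-web : ∀ {a} → fin P a → a ⊆ web P
  finitary-⊆-web {a} fa = proj₁ (Equivalence.to (isP a) fa)

  finitary-⊆ : ∀ {a b} → fin P a → b ⊆ a → fin P b
  finitary-⊆ {a} {b} fa b⊆a = Equivalence.from (isP b)
    ( (λ bx → finitary-⊆-web fa (b⊆a bx))
    , λ a' a'⊥P → finite-⊆ (λ { (a'x , bx) → a'x , b⊆a bx }) (proj₂ (Equivalence.to (isP a) fa) a' a'⊥P))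

  finite-finitary : ∀ {b} → b ⊆ web P → Finite b → fin P b
  finite-finitary {b} b⊆web fin-b = Equivalence.from (isP b) (b⊆web , λ a' _ → finite-⊆ proj₂ fin-b)

everySubset : {A : Set} → Sub A → PreFin A
web (everySubset X) = X
fin (everySubset X) a = Lift (lsuc 0ℓ) (a ⊆ X)

everySubset-fs : {A : Set} (X : Sub A) → IsFinSp (everySubset X)
everySubset-fs X a = mk⇔
  (λ a⊆X → lower a⊆X , λ a' a'⊥ → finite-⊆ (λ { (ax , a'x) → a'x , ax }) (proj₂ a'⊥ a a⊆X))
  (λ a∈bidual → lift (proj₁ a∈bidual))

finiteSubsets : {A : Set} → Sub A → PreFin A
web (finiteSubsets X) = X
fin (finiteSubsets X) a = Lift (lsuc 0ℓ) ((a ⊆ X) × Finite a)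

finiteSubsets-fs : {A : Set} (X : Sub A) → IsFinSp (finiteSubsets X)
finiteSubsets-fs X a = mk⇔
  (λ a-finite → proj₁ (lower a-finite) , λ a' _ → finite-⊆ proj₂ (proj₂ (lower a-finite)))
  (λ a∈bidual → lift (proj₁ a∈bidual ,
     finite-⊆ (λ ax → proj₁ a∈bidual ax , ax)
       (proj₂ a∈bidual X ((λ x → x) , λ b b-finite → finite-⊆ proj₁ (proj₂ (lower b-finite))))))

singleton-orth : {A : Set} (P : PreFin A) {t : A} → web P t → fin (P ⊥) (λ s → s ≡ t)
singleton-orth P {t} t∈web = (λ { refl → t∈web }) , λ a _ → t ∷ [] , λ { (_ , refl) → here refl }

_ᵀ : {A B : Set} → Rel' A B → Rel' B A
(f ᵀ) y x = f x y

≐R-sym : {A B : Set} {f g : Rel' A B} → f ≐R g → g ≐R f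
≐R-sym f≐g x y = proj₂ (f≐g x y) , proj₁ (f≐g x y)

Fam : (I : Set) → (I → Set) → Set₁
Fam I U = (i : I) → Sub (U i)

RelFam : (I : Set) → (I → Set) → Set₁
RelFam I U = (i : I) → Rel' (U i) (U i)

_⊆F_ : {I : Set} {U : I → Set} → Fam I U → Fam I U → Set
X ⊆F Y = ∀ i → X i ⊆ Y i

module RelFunctorFacts {I : Set} {U : I → Set} {V : Set} (T : RelFunctor I U V) where
  idF : Fam I U → RelFam I U
  idF X i = idR (X i)

  mor-id⁺ : ∀ X {t} → obj T X t → mor T (idF X) t t
  mor-id⁺ X {t} t∈X = proj₂ (mor-id T X t t) (t∈X , refl)

  mor-id⁻ : ∀ X {s t} → mor T (idF X) s t → obj T X s × s ≡ t
  mor-id⁻ X {s} {t} = proj₁ (mor-id T X s t)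

  mor-≐ : ∀ {f g} → (∀ i → f i ≐R g i) → ∀ {s t} → mor T f s t → mor T g s t
  mor-≐ {f} {g} f≐g {s} {t} = proj₁ (mor-resp T f g f≐g s t)

  mor-∘⁺ : ∀ f g {s t} → (mor T g ∘R mor T f) s t → mor T (λ i → g i ∘R f i) s t
  mor-∘⁺ f g {s} {t} = proj₂ (mor-∘ T f g s t)

  mor-∘⁻ : ∀ f g {s t} → mor T (λ i → g i ∘R f i) s t → (mor T g ∘R mor T f) s t
  mor-∘⁻ f g {s} {t} = proj₁ (mor-∘ T f g s t)

  mor-factor : ∀ X f g → (∀ i → (g i ∘R f i) ≐R idR (X i)) →
    ∀ {t} → obj T X t → ∃ λ s → mor T f t s × mor T g s t
  mor-factor X f g g∘f≐id t∈X =
    mor-∘⁻ f g (mor-≐ (λ i → ≐R-sym (g∘f≐id i)) (mor-id⁺ X t∈X))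

  mor-restrict : ∀ C f g → (∀ i → (f i ∘R idR (C i)) ≐R g i) →
    ∀ {s t} → mor T g s t → obj T C s × mor T f s t
  mor-restrict C f g f∘id≐g m with mor-∘⁻ (idF C) f (mor-≐ (λ i → ≐R-sym (f∘id≐g i)) m)
  ... | (w , m-id , m-f) with mor-id⁻ C m-id
  ... | (s∈C , refl) = s∈C , m-f

  mor-fixes : ∀ C f → (∀ i → (f i ∘R idR (C i)) ≐R idR (C i)) →
    ∀ {s t} → obj T C s → mor T f s t → obj T C t
  mor-fixes C f f∘id≐id {s} s∈C m
    with mor-id⁻ C (mor-≐ f∘id≐id (mor-∘⁺ (idF C) f (s , mor-id⁺ C s∈C , m)))
  ... | (s∈C , refl) = s∈C

  obj-mono : ∀ {X Y} → X ⊆F Y → obj T X ⊆ obj T Y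
  obj-mono {X} {Y} X⊆Y t∈X =
    proj₁ (mor-id⁻ Y (proj₂ (mor-restrict X (idF Y) (idF X) idY∘idX≐idX (mor-id⁺ X t∈X))))
    where
    idY∘idX≐idX : ∀ i → (idR (Y i) ∘R idR (X i)) ≐R idR (X i)
    idY∘idX≐idX i x y = (λ { (_ , (x∈X , refl) , (_ , refl)) → x∈X , refl })
                      , (λ { (x∈X , refl) → x , (x∈X , refl) , (X⊆Y i x∈X , refl) })

  obj-∩ : ∀ X Y {t} → obj T X t → obj T Y t → obj T (λ i → X i ∩ Y i) t
  obj-∩ X Y {t} t∈X t∈Y =
    proj₁ (mor-id⁻ (λ i → X i ∩ Y i)
      (mor-≐ idY∘idX≐id∩ (mor-∘⁺ (idF X) (idF Y) (t , mor-id⁺ X t∈X , mor-id⁺ Y t∈Y))))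
    where
    idY∘idX≐id∩ : ∀ i → (idR (Y i) ∘R idR (X i)) ≐R idR (X i ∩ Y i)
    idY∘idX≐id∩ i x y = (λ { (_ , (x∈X , refl) , (x∈Y , refl)) → (x∈X , x∈Y) , refl })
                      , (λ { ((x∈X , x∈Y) , refl) → x , (x∈X , refl) , (x∈Y , refl) })

-- Lax naturality of own for an inclusion X ⊆ Y: a point t of T X has the
-- same i-owners whether computed in X or in Y.
module OwnFacts {I : Set} {U : I → Set} {V : Set} (S : TransportSituation I U V) where
  open RelFunctorFacts (T S)

  owned : ∀ i X {t y} → own S i X t y → X i y
  owned i X {t} {y} o = proj₂ (own-typed S i X t y o)

  own-⊆⁻ : ∀ i {X Y} → X ⊆F Y → ∀ {t y} → obj (T S) X t → own S i Y t y → own S i X t y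
  own-⊆⁻ i {X} {Y} X⊆Y {t} {y} t∈X o
    with own-lax S i X Y (idF X) (λ { k x _ (x∈X , refl) → x∈X , X⊆Y k x∈X }) t y (t , mor-id⁺ X t∈X , o)
  ... | (_ , o' , (_ , refl)) = o'

  own-⊆⁺ : ∀ i {X Y} → X ⊆F Y → ∀ {t y} → obj (T S) X t → own S i X t y → own S i Y t y
  own-⊆⁺ i {X} {Y} X⊆Y {t} {y} t∈X o
    with own-lax S i Y X (idF X) (λ { k x _ (x∈X , refl) → X⊆Y k x∈X , x∈X }) t y (t , mor-id⁺ X t∈X , o)
  ... | (_ , o' , (_ , refl)) = o'

  Ownerless : Fam I U → Sub V
  Ownerless X s = obj (T S) X s × (∀ i y → ¬ own S i X s y)

  -- Ownerless points form a finitary set of T_own P: all their owner-images are empty.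
  ownerless-finitary : ∀ P → (∀ i → IsFinSp (P i)) → fin (Town S P) (Ownerless (λ i → web (P i)))
  ownerless-finitary P isP =
    proj₁ , λ i → FinSpace.finite-finitary (P i) (isP i)
      (λ { (_ , _ , o) → owned i _ o })
      ([] , λ { (_ , (_ , no-owner) , o) → ⊥-elim (no-owner i _ o) })

module LocalFacts {I : Set} {U : I → Set} {V : Set} (S : TransportSituation I U V) (loc : Local S) where
  open RelFunctorFacts (T S)
  open OwnFacts S

  -- The intersection clause applied to {t} and {t'}: a common owner y lies in
  -- the image of {t} ∩ {t'}, which is therefore inhabited.
  owner-determines : ∀ i X {t t' y} → obj (T S) X t → obj (T S) X t' →
    own S i X t y → own S i X t' y → t ≡ t'
  owner-determines i X {t} {t'} t∈X t'∈X o o'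
    with proj₂ (proj₂ (proj₂ (loc X i)) Bool points points⊆X)
               (owned i X o , λ { true → t , refl , o ; false → t' , refl , o' })
    where
    points : Bool → Sub V
    points true s = s ≡ t
    points false s = s ≡ t'
    points⊆X : ∀ b → points b ⊆ obj (T S) X
    points⊆X true refl = t∈X
    points⊆X false refl = t'∈X
  ... | (s , (_ , s∈points) , _) = trans (sym (s∈points true)) (s∈points false)

  -- The first clause: each y ∈ a ⊆ X i owns a point all of whose i-owners lie in a.
  owner-exists : ∀ i X {a} → a ⊆ X i → ∀ {y} → a y →
    ∃ λ t → (obj (T S) X t × (∀ z → own S i X t z → a z)) × own S i X t y
  owner-exists i X {a} a⊆X a-y = proj₂ (proj₁ (loc X i) a a⊆X) a-y

  -- The second clause, for a = ∅: the point owned by y ∈ X i has no owner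
  -- in any other coordinate k.
  owners-one-coordinate : ∀ i k X → k ≢ i → ∀ {t y z} → obj (T S) X t →
    own S i X t y → ¬ own S k X t z
  owners-one-coordinate i k X k≢i {t} {y} {z} t∈X o o-k
    with proj₂ (proj₁ (proj₂ (loc X k)) (λ _ → Empty) (λ ()) i (λ i≡k → k≢i (sym i≡k))) (owned i X o)
  ... | (t' , (t'∈X , no-k-owner) , o') with owner-determines i X t∈X t'∈X o o'
  ... | refl = no-k-owner z o-k

  -- Each point has at most one i-owner: the point owned by y with all its
  -- i-owners in {y} must be t itself.
  owner-unique : ∀ i X {t y z} → obj (T S) X t → own S i X t y → own S i X t z → z ≡ y
  owner-unique i X {t} {y} {z} t∈X o-y o-z
    with owner-exists i X {λ x → x ≡ y} (λ { refl → owned i X o-y }) refl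
  ... | (t' , (t'∈X , owners≡y) , o') with owner-determines i X t∈X t'∈X o-y o'
  ... | refl = owners≡y z o-z

  relocate : ∀ i {X Y} → Y ⊆F X → ∀ {t y} → obj (T S) X t → own S i X t y → Y i y →
    obj (T S) Y t
  relocate i {X} {Y} Y⊆X {t} {y} t∈X o y∈Y
    with owner-exists i Y {λ z → z ≡ y} (λ { refl → y∈Y }) refl
  ... | (t' , (t'∈Y , _) , o')
    with owner-determines i X t∈X (obj-mono Y⊆X t'∈Y) o (own-⊆⁺ i Y⊆X t'∈Y o')
  ... | refl = t'∈Y

-- A replication of F (inside B) is a sequence of relational copies of F,
-- all lying in the web of one finiteness space, together with a finitary
-- relation collecting every copy back onto F; distinct copies may overlap
-- only where they are identical to F, and only inside B.
record Replication {A : Set} (F B : Sub A) : Set₂ where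
  field
    source : PreFin A
    source-fs : IsFinSp source
    copy : ℕ → Rel' A A
    copies : ℕ → Sub A
    copy-typed : ∀ σ → RelIn F (web source) (copy σ)
    copies-⊆-web : ∀ σ → copies σ ⊆ web source
    copy-retract : ∀ σ → ((copy σ ᵀ) ∘R copy σ) ≐R idR F
    collect : Rel' A A
    collect-typed : RelIn (web source) F collect
    collect-finitary : Finitary source (everySubset F) collect
    collect-on-copies : ∀ σ → (collect ∘R idR (copies σ)) ≐R (copy σ ᵀ)
    overlap-fixed : ∀ σ σ' → σ ≢ σ' →
      ((copy σ ᵀ) ∘R idR (copies σ ∩ copies σ')) ≐R idR (copies σ ∩ copies σ')
    overlap-⊆ : ∀ σ σ' → σ ≢ σ' → (copies σ ∩ copies σ') ⊆ B

trivialReplication : {A : Set} {F B : Sub A} → F ⊆ B → Replication F B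
trivialReplication {F = F} F⊆B = record
  { source = everySubset F
  ; source-fs = everySubset-fs F
  ; copy = λ _ → idR F
  ; copies = λ _ → F
  ; copy-typed = λ { _ x y (x∈F , refl) → x∈F , x∈F }
  ; copies-⊆-web = λ _ x∈F → x∈F
  ; copy-retract = λ _ x y → (λ { (_ , (x∈F , refl) , (_ , refl)) → x∈F , refl })
                           , (λ { (x∈F , refl) → x , (x∈F , refl) , (x∈F , refl) })
  ; collect = idR F
  ; collect-typed = λ { x y (x∈F , refl) → x∈F , x∈F }
  ; collect-finitary =
      (λ a _ → lift λ { (_ , _ , (x∈F , refl)) → x∈F })
    , (λ b' b'⊥ → (λ { (_ , _ , (x∈F , refl)) → x∈F })
                , λ a a∈F → finite-⊆ (λ { (ax , (_ , b'x , (_ , refl))) → ax , b'x }) (proj₂ b'⊥ a a∈F))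
  ; collect-on-copies = λ _ x y → (λ { (_ , (x∈F , refl) , (_ , refl)) → x∈F , refl })
                                , (λ { (x∈F , refl) → x , (x∈F , refl) , (x∈F , refl) })
  ; overlap-fixed = λ _ _ _ x y → (λ { (_ , (x∈F∩F , refl) , (_ , refl)) → x∈F∩F , refl })
                                , (λ { (x∈F∩F , refl) → x , (x∈F∩F , refl) , (proj₁ x∈F∩F , refl) })
  ; overlap-⊆ = λ _ _ _ (x∈F , _) → F⊆B x∈F
  }

-- The fresh replication of a finite F ⊆ xs: the σ-th copy of the k-th entry of
-- xs is ι σ k, for an injective ι; distinct copies are therefore disjoint.
module FreshReplication {A : Set} (xs : List A) {F : Sub A} (F⊆xs : ∀ {x} → F x → x ∈ˡ xs)
  (ι : ℕ → Fin (length xs) → A)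
  (ι-injective : ∀ {σ σ' k k'} → ι σ k ≡ ι σ' k' → σ ≡ σ' × k ≡ k') where

  copy : ℕ → Rel' A A
  copy σ x z = ∃ λ k → lookup xs k ≡ x × F x × z ≡ ι σ k

  copies : ℕ → Sub A
  copies σ z = ∃ λ x → copy σ x z

  collect : Rel' A A
  collect z x = ∃ λ σ → copy σ x z

  copy-injective : ∀ {σ σ' x x' z} → copy σ x z → copy σ' x' z → σ ≡ σ' × x ≡ x'
  copy-injective (k , refl , _ , refl) (k' , refl , _ , z≡ι') with ι-injective z≡ι'
  ... | (σ≡σ' , refl) = σ≡σ' , refl

  copy-of : ∀ σ {x} (x∈F : F x) → copy σ x (ι σ (index (F⊆xs x∈F)))
  copy-of σ {x} x∈F = index (F⊆xs x∈F) , sym (lookup-index (F⊆xs x∈F)) , x∈F , refl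

  replication : (B : Sub A) → Replication F B
  replication B = record
    { source = finiteSubsets (λ _ → ⊤)
    ; source-fs = finiteSubsets-fs (λ _ → ⊤)
    ; copy = copy
    ; copies = copies
    ; copy-typed = λ { _ x z (_ , _ , x∈F , _) → x∈F , tt }
    ; copies-⊆-web = λ _ _ → tt
    ; copy-retract = λ σ x x' →
          (λ { (_ , c@(_ , _ , x∈F , _) , c') → x∈F , proj₂ (copy-injective c c') })
        , (λ { (x∈F , refl) → _ , copy-of σ x∈F , copy-of σ x∈F })
    ; collect = collect
    ; collect-typed = λ { z x (_ , _ , _ , x∈F , _) → tt , x∈F }
    ; collect-finitary =
        (λ a _ → lift λ { (_ , _ , (_ , _ , _ , x∈F , _)) → x∈F })
      , (λ b' _ → (λ _ → tt) , λ a a-finite → finite-⊆ proj₁ (proj₂ (lower a-finite)))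
    ; collect-on-copies = λ σ z x →
          (λ { (_ , ((_ , c) , refl) , (σ' , c')) →
                 subst (λ τ → copy τ x z) (sym (proj₁ (copy-injective c c'))) c' })
        , (λ c → z , ((x , c) , refl) , (σ , c))
    ; overlap-fixed = λ σ σ' σ≢σ' z x →
          (λ { (_ , (((_ , c) , (_ , c')) , refl) , _) → ⊥-elim (σ≢σ' (proj₁ (copy-injective c c'))) })
        , (λ { (((_ , c) , (_ , c')) , refl) → ⊥-elim (σ≢σ' (proj₁ (copy-injective c c'))) })
    ; overlap-⊆ = λ { σ σ' σ≢σ' ((_ , c) , (_ , c')) → ⊥-elim (σ≢σ' (proj₁ (copy-injective c c'))) }
    }

replicate : ExcludedMiddle 0ℓ → {A : Set} (X : Sub A) (xs : List A) (B : Sub A) →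
  (Finite X → X ⊆ B) → Replication (λ x → X x × x ∈ˡ xs) B
replicate em X xs B X⊆B with em {Finite X}
... | yes X-finite = trivialReplication (λ (x∈X , _) → X⊆B X-finite x∈X)
... | no X-infinite = FreshReplication.replication xs proj₂ ι ι-injective B
  where
  open FreshSequence (infinite-fresh em X-infinite)
  ι : ℕ → Fin (length xs) → _
  ι σ k = term (pair σ k)
  ι-injective : ∀ {σ σ' k k'} → ι σ k ≡ ι σ' k' → σ ≡ σ' × k ≡ k'
  ι-injective same = pair-injective (term-injective same)

-- The σ-th copy tσ of t (obtained through T (copy σ)) lies in T (copies σ),
-- is ownerless, and is collected back onto t.  Because T_own is a transport
-- functor, the ownerless points collected onto t form a finite set, so
-- tσ = tσ' for some σ ≢ σ'; this point then lies in T of the overlaps,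
-- where copying is the identity, so t itself lies in T of the overlaps ⊆ B.
module ReplicationLemma {I : Set} {U : I → Set} {V : Set} (S : TransportSituation I U V)
  (transport : IsTransportFunctor S) {F B : Fam I U} (R : ∀ i → Replication (F i) (B i)) where
  open RelFunctorFacts (T S)
  open OwnFacts S
  open Replication

  Source : (i : I) → PreFin (U i)
  Source i = source (R i)

  Web : Fam I U
  Web i = web (Source i)

  Target : (i : I) → PreFin (U i)
  Target i = everySubset (F i)

  Copy Copyᵀ : ℕ → RelFam I U
  Copy σ i = copy (R i) σ
  Copyᵀ σ i = copy (R i) σ ᵀ

  Copies : ℕ → Fam I U
  Copies σ i = copies (R i) σ

  Collect : RelFam I U
  Collect i = collect (R i)

  collect-finitary-T : Finitary (Town S Source) (Town S Target) (mor (T S) Collect)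
  collect-finitary-T = transport Source Target (λ i → source-fs (R i)) (λ i → everySubset-fs (F i))
    Collect (λ i → collect-typed (R i)) (λ i → collect-finitary (R i))

  module _ {t : V} (t∈F : obj (T S) F t) (no-owner : ∀ i y → ¬ own S i F t y) where
    copy-exists : ∀ σ → ∃ λ s → mor (T S) (Copy σ) t s × mor (T S) (Copyᵀ σ) s t
    copy-exists σ = mor-factor F (Copy σ) (Copyᵀ σ) (λ i → copy-retract (R i) σ) t∈F

    copy-point : ℕ → V
    copy-point σ = proj₁ (copy-exists σ)

    copy-point-in-copies : ∀ σ → obj (T S) (Copies σ) (copy-point σ) × mor (T S) Collect (copy-point σ) t
    copy-point-in-copies σ = mor-restrict (Copies σ) Collect (Copyᵀ σ)
      (λ i → collect-on-copies (R i) σ) (proj₂ (proj₂ (copy-exists σ)))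

    -- An owner of tσ would, by lax naturality of own along Copy σ, come
    -- from an owner of t.
    copy-point-ownerless : ∀ σ → Ownerless Web (copy-point σ)
    copy-point-ownerless σ =
      obj-mono (λ i → copies-⊆-web (R i) σ) (proj₁ (copy-point-in-copies σ)) , no-owner-σ
      where
      no-owner-σ : ∀ i y → ¬ own S i Web (copy-point σ) y
      no-owner-σ i y o with own-lax S i F Web (Copy σ) (λ k → copy-typed (R k) σ) t y
                              (copy-point σ , proj₁ (proj₂ (copy-exists σ)) , o)
      ... | (x , o-x , _) = no-owner i x o-x

    -- The copies of t lie in the finite set of ownerless points collected onto
    -- t: finite because T Collect is finitary and {t} is orthogonal to T_own Target.
    collected-finite : Finite (Ownerless Web ∩ rimage (mor (T S) Collect) (λ s → s ≡ t))
    collected-finite =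
      proj₂ (proj₂ collect-finitary-T (λ s → s ≡ t) (singleton-orth (Town S Target) t∈F))
        (Ownerless Web) (ownerless-finitary Source (λ i → source-fs (R i)))

    copies-collide : ∃ λ σ → ∃ λ σ' → σ ≢ σ' × copy-point σ ≡ copy-point σ'
    copies-collide = sequence-repeats (proj₁ collected-finite) copy-point λ σ →
      proj₂ collected-finite {copy-point σ}
        (copy-point-ownerless σ , t , refl , proj₂ (copy-point-in-copies σ))

    -- A collision σ ≢ σ' puts tσ into T of the overlaps, where copying
    -- back is the identity, so t lies there too, hence in T B.
    collision-in-B : ∀ σ σ' → σ ≢ σ' → copy-point σ ≡ copy-point σ' → obj (T S) B t
    collision-in-B σ σ' σ≢σ' tσ≡tσ' =
      obj-mono {Overlap} {B} (λ i → overlap-⊆ (R i) σ σ' σ≢σ')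
        (mor-fixes Overlap (Copyᵀ σ) (λ i → overlap-fixed (R i) σ σ' σ≢σ') {copy-point σ} {t}
          tσ∈Overlap (proj₂ (proj₂ (copy-exists σ))))
      where
      Overlap : Fam I U
      Overlap i = Copies σ i ∩ Copies σ' i
      tσ∈Overlap : obj (T S) Overlap (copy-point σ)
      tσ∈Overlap = obj-∩ (Copies σ) (Copies σ') {copy-point σ} (proj₁ (copy-point-in-copies σ))
        (subst (obj (T S) (Copies σ')) (sym tσ≡tσ') (proj₁ (copy-point-in-copies σ')))

    ownerless-in-B : obj (T S) B t
    ownerless-in-B =
      let (σ , σ' , σ≢σ' , tσ≡tσ') = copies-collide in collision-in-B σ σ' σ≢σ' tσ≡tσ'

-- By continuity, every point of T X already lies in T of finite parts of X.
finite-support : {I : Set} {U : I → Set} {V : Set} (T : RelFunctor I U V) → Continuous T →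
  ∀ {X t} → obj T X t → ∃ λ (xs : (i : I) → List (U i)) → obj T (λ i x → X i x × x ∈ˡ xs i) t
finite-support {I} {U} T cont {X} t∈X =
  proj₁ (cont (λ i → List (U i)) FinitePart parts-directed)
    (obj-mono (λ i {x} x∈X → x ∷ [] , x∈X , here refl) t∈X)
  where
  open RelFunctorFacts T
  FinitePart : (i : I) → List (U i) → Sub (U i)
  FinitePart i xs x = X i x × x ∈ˡ xs
  parts-directed : ∀ i → Directed _⊆_ (FinitePart i)
  parts-directed i = record
    { inhabited = []
    ; upper = λ xs ys → xs ++ ys , (λ (x∈X , x∈xs) → x∈X , ∈-++⁺ˡ x∈xs)
                                 , (λ (x∈X , x∈ys) → x∈X , ∈-++⁺ʳ xs x∈ys) }

-- Ownerless points of T X lie in T B for every B that contains each finite X i: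
-- pass to a finite support, replicate it, and apply the key lemma.
ownerless-everywhere : ExcludedMiddle 0ℓ → {I : Set} {U : I → Set} {V : Set}
  (S : TransportSituation I U V) → IsTransportFunctor S → Continuous (T S) →
  ∀ {X t} → OwnFacts.Ownerless S X t →
  ∀ B → (∀ i → Finite (X i) → X i ⊆ B i) → obj (T S) B t
ownerless-everywhere em S transport cont {X} (t∈X , no-owner) B X⊆B
  with finite-support (T S) cont t∈X
... | (xs , t∈Xxs) =
  ReplicationLemma.ownerless-in-B S transport {F = Support} {B = B}
    (λ i → replicate em (X i) (xs i) (B i) (X⊆B i)) t∈Xxs no-owner-in-support
  where
  Support : Fam _ _
  Support i x = X i x × x ∈ˡ xs i
  no-owner-in-support : ∀ i y → ¬ own S i Support _ y
  no-owner-in-support i y o =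
    no-owner i y (OwnFacts.own-⊆⁺ S i {Support} {X} (λ _ → proj₁) t∈Xxs o)

directed-webs : {A J : Set} {P : J → PreFin A} → Directed _⊑_ P → Directed _⊆_ (λ j → web (P j))
directed-webs dir = record
  { inhabited = Directed.inhabited dir
  ; upper = λ j k → let (l , P-j⊑l , P-k⊑l) = Directed.upper dir j k in l , proj₁ P-j⊑l , proj₁ P-k⊑l }

directed-cover : ExcludedMiddle 0ℓ → {A J : Set} {W : J → Sub A} → Directed _⊆_ W →
  ∀ {a} → Finite a → a ⊆ (λ x → ∃ λ j → W j x) → ∃ λ j → a ⊆ W j
directed-cover em {A} {J} {W} dir {a} (xs , a⊆xs) a⊆⋃W =
  proj₁ (cover xs) , λ ax → proj₂ (cover xs) (a⊆xs ax) ax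
  where
  cover : (ys : List A) → ∃ λ j → ∀ {y} → y ∈ˡ ys → a y → W j y
  cover [] = Directed.inhabited dir , λ ()
  cover (y ∷ ys) with cover ys | em {a y}
  ... | (j , ys⊆W) | no ¬ay = j , λ { (here refl) ay → ⊥-elim (¬ay ay) ; (there y∈ys) → ys⊆W y∈ys }
  ... | (j , ys⊆W) | yes ay =
    let (k , y∈W) = a⊆⋃W ay ; (l , W-j⊆l , W-k⊆l) = Directed.upper dir j k
    in l , λ { (here refl) _ → W-k⊆l y∈W ; (there y∈ys) ay' → W-j⊆l (ys⊆W y∈ys ay') }

-- A dependent function over a type with decidable equality can be updated at
-- one point (uniqueness of identity proofs makes the new value come out exactly).
update : {I : Set} {J : I → Set} → DecidableEquality I → ((k : I) → J k) →
  ∀ i (x : J i) → ∃ λ (g : (k : I) → J k) → g i ≡ x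
update {I} {J} _≟_ f i x = (λ k → pick k (k ≟ i)) , pick-i (i ≟ i)
  where
  pick : ∀ k → Dec (k ≡ i) → J k
  pick k (yes k≡i) = subst J (sym k≡i) x
  pick k (no _) = f k
  pick-i : (d : Dec (i ≡ i)) → pick i d ≡ x
  pick-i (yes i≡i) = cong (λ e → subst J (sym e) x) (Decidable⇒UIP.≡-irrelevant _≟_ i≡i refl)
  pick-i (no i≢i) = ⊥-elim (i≢i refl)

-- Monotonicity: T is monotone on webs, and for a point of the smaller web the
-- owners computed in the larger web are the same, so owner-images shrink.
Town-monotone : {I : Set} {U : I → Set} {V : Set} (S : TransportSituation I U V) →
  ∀ (P Q : (i : I) → PreFin (U i)) → (∀ i → IsFinSp (Q i)) →
  (∀ i → P i ⊑ Q i) → Town S P ⊑ Town S Q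
Town-monotone S P Q isQ P⊑Q =
  obj-mono webP⊆webQ ,
  λ â â-finitary →
      (λ t∈â → obj-mono webP⊆webQ (proj₁ â-finitary t∈â))
    , λ i → FinSpace.finitary-⊆ (Q i) (isQ i) (proj₂ (P⊑Q i) _ (proj₂ â-finitary i))
              (λ { (t , t∈â , o) → t , t∈â , own-⊆⁻ i webP⊆webQ (proj₁ â-finitary t∈â) o })
  where
  open RelFunctorFacts (T S)
  open OwnFacts S
  webP⊆webQ : (λ i → web (P i)) ⊆F (λ i → web (Q i))
  webP⊆webQ i = proj₁ (P⊑Q i)

-- The webs of both sides agree by
-- continuity of T.  For the structures, the owner-images of a set orthogonal
-- to the supremum are orthogonal to every P i j; the inclusion into the
-- supremum then covers the relevant owners by a single js (directedness),
-- using the ownerless lemma for points without owners, and the converse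
-- inclusion pulls a set orthogonal to the P i j back along own i.
module Continuity (em : ∀ {ℓ} → ExcludedMiddle ℓ) {I : Set} {U : I → Set} {V : Set}
  (S : TransportSituation I U V) (transport : IsTransportFunctor S)
  (cont : Continuous (T S)) (loc : Local S)
  (J : I → Set) (P : (i : I) → J i → PreFin (U i))
  (isP : ∀ i j → IsFinSp (P i j)) (dir : ∀ i → Directed _⊑_ (P i)) where
  open RelFunctorFacts (T S)
  open OwnFacts S
  open LocalFacts S loc

  A : Fam I U
  A i = web (⨆ (P i))

  W : ((i : I) → J i) → Fam I U
  W js i = web (P i (js i))

  W⊆A : ∀ js → W js ⊆F A
  W⊆A js i x∈W = js i , x∈W

  Sup : PreFin V
  Sup = ⨆ (λ (js : (i : I) → J i) → Town S (λ i → P i (js i)))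

  Generator : Sub V → Set₁
  Generator ĉ = ∃ λ (js : (i : I) → J i) → fin (Town S (λ i → P i (js i))) ĉ

  webs-agree : obj (T S) A ≐ web Sup
  webs-agree = cont J (λ i j → web (P i j)) (λ i → directed-webs (dir i))

  OwnedIn : ∀ i → Fam I U → Sub (U i) → Sub V
  OwnedIn i X a t = obj (T S) X t × ∃ λ y → a y × own S i X t y

  -- Its i-image is inside a (owners are unique), its other images are empty.
  owned-in-finitary : ∀ i js {a} → fin (P i (js i)) a →
    fin (Town S (λ k → P k (js k))) (OwnedIn i (W js) a)
  owned-in-finitary i js {a} a-finitary = proj₁ , images-finitary
    where
    images-finitary : ∀ k → fin (P k (js k)) (image (own S k (W js)) (OwnedIn i (W js) a))
    images-finitary k with em {P = k ≡ i}
    ... | yes refl = FinSpace.finitary-⊆ (P i (js i)) (isP i (js i)) a-finitary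
      λ { (t , (t∈W , y , ay , o-y) , o-z) → subst a (sym (owner-unique i (W js) t∈W o-y o-z)) ay }
    ... | no k≢i = FinSpace.finite-finitary (P k (js k)) (isP k (js k))
      (λ { (_ , _ , o) → owned k (W js) o })
      ([] , λ { (t , (t∈W , y , ay , o-y) , o-z) → ⊥-elim (owners-one-coordinate i k (W js) k≢i t∈W o-y o-z) })

  -- Owner-images of sets orthogonal to the supremum are orthogonal to each P i j:
  -- against a ∈ P i j, test with the generator of points owned in a.
  own-image-orth : ∀ {b'} → Orth (web Sup) Generator b' →
    ∀ i → Orth (A i) (λ a → ∃ λ j → fin (P i j) a) (image (own S i A) b')
  own-image-orth {b'} b'-orth i = (λ { (_ , _ , o) → owned i A o }) , meets-finite
    where
    meets-finite : ∀ a → (∃ λ j → fin (P i j) a) → Finite (a ∩ image (own S i A) b')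
    meets-finite a (j , a-finitary) with update (λ k k' → em) (λ k → Directed.inhabited (dir k)) i j
    ... | (js , refl) =
      finite-⊆ meet⊆image
        (image-finite (own S i A) (own-qf S i A) (proj₂ b'-orth _ (js , owned-in-finitary i js a-finitary)))
      where
      meet⊆image : (a ∩ image (own S i A) b') ⊆ image (own S i A) (OwnedIn i (W js) a ∩ b')
      meet⊆image (ay , t , b't , o) =
        let t∈W = relocate i (W⊆A js) (proj₂ webs-agree (proj₁ b'-orth b't)) o
                    (FinSpace.finitary-⊆-web (P i (js i)) (isP i (js i)) a-finitary ay)
        in t , ((t∈W , _ , ay , own-⊆⁻ i (W⊆A js) t∈W o) , b't) , o

  module ToSupremum (â : Sub V) (â-finitary : fin (Town S (λ i → ⨆ (P i))) â)
                    (b' : Sub V) (b'-orth : Orth (web Sup) Generator b') where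
    â⊆A : â ⊆ obj (T S) A
    â⊆A = proj₁ â-finitary

    shared-owners-finite : ∀ i → Finite (image (own S i A) b' ∩ image (own S i A) â)
    shared-owners-finite i = proj₂ (proj₂ â-finitary i) _ (own-image-orth b'-orth i)

    Relevant : ∀ i → Sub (U i)
    Relevant i y = (image (own S i A) b' ∩ image (own S i A) â) y ⊎ (Finite (A i) × A i y)

    relevant-cover : ∀ i → ∃ λ j → Relevant i ⊆ web (P i j)
    relevant-cover i = directed-cover em (directed-webs (dir i))
      (finite-⊎ (shared-owners-finite i) (finite-if-finite em (A i)))
      (λ { (inj₁ (_ , (_ , _ , o))) → owned i A o ; (inj₂ (_ , Ay)) → Ay })

    js : (i : I) → J i
    js i = proj₁ (relevant-cover i)

    meet⊆W : (â ∩ b') ⊆ obj (T S) (W js)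
    meet⊆W {t} (ât , b't) with em {P = ∃ λ i → ∃ λ y → own S i A t y}
    ... | yes (i , y , o) =
      relocate i (W⊆A js) (â⊆A ât) o (proj₂ (relevant-cover i) (inj₁ ((t , b't , o) , (t , ât , o))))
    ... | no no-owner =
      ownerless-everywhere em S transport cont (â⊆A ât , λ i y o → no-owner (i , y , o)) (W js)
        (λ i A-finite Ay → proj₂ (relevant-cover i) (inj₂ (A-finite , Ay)))

    meet-generator : Generator (â ∩ b')
    meet-generator = js , meet⊆W , λ i →
      FinSpace.finite-finitary (P i (js i)) (isP i (js i)) (λ { (_ , _ , o) → owned i (W js) o })
        (finite-⊆ (λ { (t , (ât , b't) , o) →
                       let o' = own-⊆⁺ i (W⊆A js) (meet⊆W (ât , b't)) o
                       in (t , b't , o') , (t , ât , o') })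
          (shared-owners-finite i))

    meet-finite : Finite (b' ∩ â)
    meet-finite = finite-⊆ (λ { (b't , ât) → (ât , b't) , b't }) (proj₂ b'-orth _ meet-generator)

  to-supremum : ∀ â → fin (Town S (λ i → ⨆ (P i))) â → fin Sup â
  to-supremum â â-finitary =
    (λ ât → proj₁ webs-agree (proj₁ â-finitary ât)) ,
    λ b' b'-orth → ToSupremum.meet-finite â â-finitary b' b'-orth

  -- The supremum of the T_own is included in T_own of the suprema: for a'
  -- orthogonal to every P i j, the points owned in a' are orthogonal to the
  -- supremum, as each generator meets them in points labelled by distinct
  -- owners from a finite set.
  module FromSupremum (â : Sub V) (â-finitary : fin Sup â) (i : I) (a' : Sub (U i))
                      (a'-orth : Orth (A i) (λ a → ∃ λ j → fin (P i j) a) a') where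
    owned-orth : Orth (web Sup) Generator (OwnedIn i A a')
    owned-orth = (λ { (t∈A , _) → proj₁ webs-agree t∈A }) , meets-finite
      where
      meets-finite : ∀ ĉ → Generator ĉ → Finite (ĉ ∩ OwnedIn i A a')
      meets-finite ĉ (js , ĉ⊆W , ĉ-images) =
        finite-by-labels em (own S i A) (proj₂ a'-orth _ (js i , ĉ-images i))
          (λ { (_ , t∈A , _) (_ , t'∈A , _) → owner-determines i A t∈A t'∈A })
          (λ { {t} (ĉt , _ , y , a'y , o) →
                 y , ((t , ĉt , own-⊆⁻ i (W⊆A js) (ĉ⊆W ĉt) o) , a'y) , o })

    meet-finite : Finite (a' ∩ image (own S i A) â)
    meet-finite =
      finite-⊆ (λ { (a'y , t , ât , o) → t , ((proj₂ webs-agree (proj₁ â-finitary ât) , _ , a'y , o) , ât) , o })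
        (image-finite (own S i A) (own-qf S i A) (proj₂ â-finitary _ owned-orth))

  from-supremum : ∀ â → fin Sup â → fin (Town S (λ i → ⨆ (P i))) â
  from-supremum â â-finitary =
    (λ ât → proj₂ webs-agree (proj₁ â-finitary ât)) ,
    λ i → (λ { (_ , _ , o) → owned i A o }) , FromSupremum.meet-finite â â-finitary i

  continuity : Town S (λ i → ⨆ (P i)) ≈F Sup
  continuity = webs-agree , λ â → mk⇔ (to-supremum â) (from-supremum â)

lemma12 : (∀ {ℓ} → ExcludedMiddle ℓ) →
    ∀ {I : Set} {U : I → Set} {V : Set} (S : TransportSituation I U V) →
    IsTransportFunctor S → Continuous (T S) → Local S →
    DirectlyContinuous S
lemma12 em S transport cont loc =
    (λ P Q _ isQ → Town-monotone S P Q isQ)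
  , (λ J P isP dir → Continuity.continuity em S transport cont loc J P isP dir)
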